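{- There is a finitely generated structure $\mathcal{A}$ such that $\mathrm{Th}_2(\mathcal{A})$ is not quasi-categorical.
   Context: Formulas are in $\mathcal{L}_{\omega_1\omega}$; $\Sigma^0_2$ sentences are countable disjunctions of $\exists\bar x\,\phi$ with $\phi$ a countable conjunction of $\forall\bar y\,\theta$ ($\theta$ finitary quantifier-free), and $\Pi^0_2$ sentences are countable conjunctions of $\forall\bar x\,\phi$ with $\phi$ a countable disjunction of $\exists\bar y\,\theta$. The 2-theory $\mathrm{Th}_2(\mathcal{A})$ is the set of $\Sigma^0_2$ and $\Pi^0_2$ sentences true in $\mathcal{A}$. For finitely generated $\mathcal{A}$, $\mathrm{Th}_2(\mathcal{A})$ is quasi-categorical if $\mathcal{A}$ is, up to isomorphism, the only finitely generated model of $\mathrm{Th}_2(\mathcal{A})$. -}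

module Defs where

open import Data.Nat using (ℕ; _+_)
open import Data.Fin using (Fin)
open import Data.Vec using (Vec; []; _∷_)
import Data.Vec as V
open import Data.Vec.Functional using (Vector; _++_)
open import Data.Product using (Σ; _×_; _,_)
open import Data.Sum using (_⊎_)
open import Data.Unit using (⊤)
open import Data.Empty using (⊥)
open import Relation.Nullary using (¬_)
open import Relation.Binary.PropositionalEquality using (_≡_)
open import Function.Definitions using (Injective)

record Signature : Set₁ where
  field
    Fun      : Set
    funArity : Fun → ℕ
    Rel      : Set
    relArity : Rel → ℕ
    funCode  : Fun → ℕ
    funCode-inj : Injective _≡_ _≡_ funCode
    relCode  : Rel → ℕ
    relCode-inj : Injective _≡_ _≡_ relCode

module _ (L : Signature) where
  open Signature L

  record Structure : Set₁ where
    field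
      Carrier : Set
      funI    : (f : Fun) → Vec Carrier (funArity f) → Carrier
      relI    : (r : Rel) → Vec Carrier (relArity r) → Set

  data Term (n : ℕ) : Set where
    var : Fin n → Term n
    app : (f : Fun) → Vec (Term n) (funArity f) → Term n

  module _ (A : Structure) where
    open Structure A

    mutual
      evalT : ∀ {n} → (Fin n → Carrier) → Term n → Carrier
      evalT ρ (var i)    = ρ i
      evalT ρ (app f ts) = funI f (evalTs ρ ts)

      evalTs : ∀ {n k} → (Fin n → Carrier) → Vec (Term n) k → Vec Carrier k
      evalTs ρ []       = []
      evalTs ρ (t ∷ ts) = evalT ρ t ∷ evalTs ρ ts

  data QF (n : ℕ) : Set where
    tt ff : QF n
    eq    : Term n → Term n → QF n
    rel   : (r : Rel) → Vec (Term n) (relArity r) → QF n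
    neg   : QF n → QF n
    and or : QF n → QF n → QF n

  module _ (A : Structure) where
    open Structure A

    SatQF : ∀ {n} → (Fin n → Carrier) → QF n → Set
    SatQF ρ tt = ⊤
    SatQF ρ ff = ⊥
    SatQF ρ (eq s t) = evalT A ρ s ≡ evalT A ρ t
    SatQF ρ (rel r ts) = relI r (evalTs A ρ ts)
    SatQF ρ (neg φ) = ¬ SatQF ρ φ
    SatQF ρ (and φ ψ) = SatQF ρ φ × SatQF ρ ψ
    SatQF ρ (or φ ψ) = SatQF ρ φ ⊎ SatQF ρ ψ

  -- Countable conjunction of ∀ȳ θ (free variables Fin n):
  -- the i-th conjunct is ∀ y₁…yₘ θ with θ : QF (n + m).
  Π1Form : ℕ → Set
  Π1Form n = ℕ → Σ ℕ (λ m → QF (n + m))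

  -- Countable disjunction of ∃ȳ θ (free variables Fin n).
  Σ1Form : ℕ → Set
  Σ1Form n = ℕ → Σ ℕ (λ m → QF (n + m))

  -- Σ⁰₂ sentence: countable disjunction of ∃x̄ (Π1-formula in x̄).
  Σ2Sentence : Set
  Σ2Sentence = ℕ → Σ ℕ Π1Form

  -- Π⁰₂ sentence: countable conjunction of ∀x̄ (Σ1-formula in x̄).
  Π2Sentence : Set
  Π2Sentence = ℕ → Σ ℕ Σ1Form

  module _ (A : Structure) where
    open Structure A

    SatΠ1 : ∀ {n} → (Fin n → Carrier) → Π1Form n → Set
    SatΠ1 {n} ρ φ = ∀ i → SatConj (φ i)
      where
      SatConj : Σ ℕ (λ m → QF (n + m)) → Set
      SatConj (m , θ) = (ys : Fin m → Carrier) → SatQF A (ρ ++ ys) θ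

    SatΣ1 : ∀ {n} → (Fin n → Carrier) → Σ1Form n → Set
    SatΣ1 {n} ρ φ = Σ ℕ (λ i → SatDisj (φ i))
      where
      SatDisj : Σ ℕ (λ m → QF (n + m)) → Set
      SatDisj (m , θ) = Σ (Fin m → Carrier) (λ ys → SatQF A (ρ ++ ys) θ)

    SatΣ2 : Σ2Sentence → Set
    SatΣ2 φ = Σ ℕ (λ i → SatD (φ i))
      where
      SatD : Σ ℕ Π1Form → Set
      SatD (k , ψ) = Σ (Fin k → Carrier) (λ xs → SatΠ1 xs ψ)

    SatΠ2 : Π2Sentence → Set
    SatΠ2 φ = ∀ i → SatC (φ i)
      where
      SatC : Σ ℕ Σ1Form → Set
      SatC (k , ψ) = (xs : Fin k → Carrier) → SatΣ1 xs ψ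

  ModelOfTh2 : Structure → Structure → Set
  ModelOfTh2 A B =
    ((φ : Σ2Sentence) → SatΣ2 A φ → SatΣ2 B φ) ×
    ((φ : Π2Sentence) → SatΠ2 A φ → SatΠ2 B φ)

  FinitelyGenerated : Structure → Set
  FinitelyGenerated A =
    Σ ℕ (λ n → Σ (Fin n → Carrier) (λ g →
      (a : Carrier) → Σ (Term n) (λ t → evalT A g t ≡ a)))
    where open Structure A

  record Iso (A B : Structure) : Set where
    private
      module A = Structure A
      module B = Structure B
    field
      to      : A.Carrier → B.Carrier
      from    : B.Carrier → A.Carrier
      from-to : ∀ a → from (to a) ≡ a
      to-from : ∀ b → to (from b) ≡ b
      pres-fun : ∀ f (as : Vec A.Carrier (funArity f)) →
                 to (A.funI f as) ≡ B.funI f (V.map to as)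
      pres-rel : ∀ r (as : Vec A.Carrier (relArity r)) →
                 A.relI r as → B.relI r (V.map to as)
      refl-rel : ∀ r (as : Vec A.Carrier (relArity r)) →
                 B.relI r (V.map to as) → A.relI r as

  QuasiCategoricalTh2 : Structure → Set₁
  QuasiCategoricalTh2 A =
    (B : Structure) → FinitelyGenerated B → ModelOfTh2 A B → Iso A B

module Submission where

-- The structure is a forest over ℕ: countably many roots r₀, r₁, …, each the
-- root of a copy of the ω-branching tree of finite label sequences.  The unary
-- function "up" sends a node to its parent and a root rⱼ to rⱼ₊₁; the unary
-- functions "child i" descend along label i.  A unary predicate P marks the
-- nodes whose number of steps from r₀ (ups between roots plus depth) is even
-- (structure A), resp. odd (structure B).  Both are generated by r₀.
--
-- 1. General model theory: an injective map commuting with the function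
--    symbols of a fragment and preserving/reflecting relations respects every
--    quantifier-free formula over that fragment; and if each structure
--    "covers" the other (every finite tuple is the image of a tuple under maps
--    respecting any single qf formula), Σ⁰₂ and Π⁰₂ truth transfers.
-- 2. In the forest, the shift D_c (pushing tree r₀ under the child-c slot of r₀,
--    merging tree r₁ into r₀ and moving the other roots down) is such a map for
--    the fragment of symbols below c; it flips the predicate, so A and B cover
--    each other and B ⊨ Th₂(A).
-- 3. An isomorphism A ≅ B must send r₀ — the unique root that is not "up" of a
--    root — to itself, contradicting that P holds at r₀ in A but not in B.

open import Defs
open import Data.Bool using (Bool; true; false; not)
open import Data.Bool.Properties using (not-involutive; not-injective)
open import Data.Empty using (⊥; ⊥-elim)
open import Data.Fin using (Fin; splitAt)
import Data.Fin as F
open import Data.List using (List; []; _∷_; [_]; _++_)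
open import Data.List.Properties using (∷-injectiveˡ; ∷-injectiveʳ; ++-cancelʳ)
open import Data.Nat using (ℕ; zero; suc; _+_; _≤_; _<_; _⊔_; _<?_; pred; s≤s)
open import Data.Nat.ListAction using (sum)
open import Data.Nat.Properties
  using (≤-refl; ≤-trans; <-trans; <-irrefl; ≤-<-trans; n≤1+n; n<1+n; m≤m+n; m≤n+m;
         m≤m⊔n; m≤n⊔m; m⊔n≤o⇒m≤o; m⊔n≤o⇒n≤o)
open import Data.Product using (Σ; _×_; _,_; proj₁; proj₂)
open import Data.Product.Function.NonDependent.Propositional using (_×-⇔_)
open import Data.Sum using (inj₁; inj₂)
open import Data.Sum.Function.Propositional using (_⊎-⇔_)
open import Data.Unit using (⊤; tt)
open import Data.Vec using (Vec; []; _∷_)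
import Data.Vec as V
import Data.Vec.Functional as VF
open import Function using (_∘_; id; _⇔_; mk⇔; Equivalence)
open import Function.Related.TypeIsomorphisms using (¬-cong-⇔)
open import Relation.Binary.PropositionalEquality
  using (_≡_; _≢_; refl; sym; trans; cong; cong₂; subst; module ≡-Reasoning)
open import Relation.Nullary using (¬_; yes; no)

open Structure using (Carrier)

module _ {L : Signature} where
  open Signature L

  mutual
    WithinT : (Fun → Set) → ∀ {n} → Term L n → Set
    WithinT S (var i)    = ⊤
    WithinT S (app f ts) = S f × WithinTs S ts

    WithinTs : (Fun → Set) → ∀ {n k} → Vec (Term L n) k → Set
    WithinTs S []       = ⊤
    WithinTs S (t ∷ ts) = WithinT S t × WithinTs S ts

  WithinQF : (Fun → Set) → ∀ {n} → QF L n → Set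
  WithinQF S tt         = ⊤
  WithinQF S ff         = ⊤
  WithinQF S (eq s t)   = WithinT S s × WithinT S t
  WithinQF S (rel r ts) = WithinTs S ts
  WithinQF S (neg φ)    = WithinQF S φ
  WithinQF S (and φ ψ)  = WithinQF S φ × WithinQF S ψ
  WithinQF S (or φ ψ)   = WithinQF S φ × WithinQF S ψ

  record FragmentEmbedding (S : Fun → Set) (X Y : Structure L) : Set where
    private
      module X = Structure X
      module Y = Structure Y
    field
      embed       : X.Carrier → Y.Carrier
      injective   : ∀ {a b} → embed a ≡ embed b → a ≡ b
      embed-fun   : ∀ f → S f → (as : Vec X.Carrier (funArity f)) →
                    embed (X.funI f as) ≡ Y.funI f (V.map embed as)
      embed-rel   : ∀ r (as : Vec X.Carrier (relArity r)) →
                    X.relI r as ⇔ Y.relI r (V.map embed as)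

  -- e respects θ: θ holds of an assignment in X iff it holds of its image in
  -- Y.  The image assignment ρ' is given pointwise, since functions are not
  -- compared extensionally.
  Respects : (X Y : Structure L) → (Carrier X → Carrier Y) → ∀ {n} → QF L n → Set
  Respects X Y e {n} θ =
    (ρ : Fin n → Carrier X) (ρ' : Fin n → Carrier Y) → (∀ i → ρ' i ≡ e (ρ i)) →
    SatQF L X ρ θ ⇔ SatQF L Y ρ' θ

  module _ {S : Fun → Set} {X Y : Structure L} (E : FragmentEmbedding S X Y) where
    private
      module X = Structure X
      module Y = Structure Y
    open FragmentEmbedding E

    mutual
      embed-evalT : ∀ {n} {ρ : Fin n → X.Carrier} {ρ'} → (∀ i → ρ' i ≡ embed (ρ i)) →
                    (t : Term L n) → WithinT S t →
                    evalT L Y ρ' t ≡ embed (evalT L X ρ t)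
      embed-evalT ρ'≡ (var i) _ = ρ'≡ i
      embed-evalT {ρ = ρ} {ρ'} ρ'≡ (app f ts) (Sf , wts) = begin
        Y.funI f (evalTs L Y ρ' ts)            ≡⟨ cong (Y.funI f) (embed-evalTs ρ'≡ ts wts) ⟩
        Y.funI f (V.map embed (evalTs L X ρ ts)) ≡⟨ sym (embed-fun f Sf _) ⟩
        embed (X.funI f (evalTs L X ρ ts))     ∎
        where open ≡-Reasoning

      embed-evalTs : ∀ {n k} {ρ : Fin n → X.Carrier} {ρ'} → (∀ i → ρ' i ≡ embed (ρ i)) →
                     (ts : Vec (Term L n) k) → WithinTs S ts →
                     evalTs L Y ρ' ts ≡ V.map embed (evalTs L X ρ ts)
      embed-evalTs ρ'≡ [] _ = refl
      embed-evalTs ρ'≡ (t ∷ ts) (wt , wts) =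
        cong₂ _∷_ (embed-evalT ρ'≡ t wt) (embed-evalTs ρ'≡ ts wts)

    embedding-respects : ∀ {n} (θ : QF L n) → WithinQF S θ → Respects X Y embed θ
    embedding-respects tt _ ρ ρ' ρ'≡ = mk⇔ id id
    embedding-respects ff _ ρ ρ' ρ'≡ = mk⇔ id id
    embedding-respects (eq s t) (ws , wt) ρ ρ' ρ'≡ = mk⇔
      (λ s≡t → trans evs (trans (cong embed s≡t) (sym evt)))
      (λ s≡t → injective (trans (sym evs) (trans s≡t evt)))
      where
      evs : evalT L Y ρ' s ≡ embed (evalT L X ρ s)
      evs = embed-evalT ρ'≡ s ws
      evt : evalT L Y ρ' t ≡ embed (evalT L X ρ t)
      evt = embed-evalT ρ'≡ t wt
    embedding-respects (rel r ts) wts ρ ρ' ρ'≡ = mk⇔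
      (λ h → subst (Y.relI r) (sym evts) (Equivalence.to (embed-rel r _) h))
      (λ h → Equivalence.from (embed-rel r _) (subst (Y.relI r) evts h))
      where
      evts : evalTs L Y ρ' ts ≡ V.map embed (evalTs L X ρ ts)
      evts = embed-evalTs ρ'≡ ts wts
    embedding-respects (neg φ) w ρ ρ' ρ'≡ =
      ¬-cong-⇔ (embedding-respects φ w ρ ρ' ρ'≡)
    embedding-respects (and φ ψ) (wφ , wψ) ρ ρ' ρ'≡ =
      embedding-respects φ wφ ρ ρ' ρ'≡ ×-⇔ embedding-respects ψ wψ ρ ρ' ρ'≡
    embedding-respects (or φ ψ) (wφ , wψ) ρ ρ' ρ'≡ =
      embedding-respects φ wφ ρ ρ' ρ'≡ ⊎-⇔ embedding-respects ψ wψ ρ ρ' ρ'≡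

  Covers : Structure L → Structure L → Set
  Covers X Y = ∀ {k} (ys : Fin k → Carrier Y) → Σ (Fin k → Carrier X) λ xs →
    ∀ {m} (θ : QF L (k + m)) → Σ (Carrier X → Carrier Y) λ e →
      (∀ j → e (xs j) ≡ ys j) × Respects X Y e θ

++-image : ∀ {A B : Set} {k m} (e : A → B) {xs : Fin k → A} {ys : Fin k → B} →
           (∀ j → e (xs j) ≡ ys j) → (zs : Fin m → A) →
           ∀ i → (ys VF.++ (e ∘ zs)) i ≡ e ((xs VF.++ zs) i)
++-image {k = k} e exs≡ys zs i with splitAt k i
... | inj₁ j = sym (exs≡ys j)
... | inj₂ j = refl

module _ {L : Signature} {X Y : Structure L} where

  -- A true Σ⁰₂ sentence ∃x̄ ∀ȳ θ in X with witness x̄ stays true in Y at a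
  -- covering tuple: a counterexample ȳ in Y maps to one in X.
  Σ2-transfer : Covers Y X → ∀ φ → SatΣ2 L X φ → SatΣ2 L Y φ
  Σ2-transfer cover φ (i , xs , sat) with cover xs
  ... | ys , covering = i , ys , λ l zs →
    let e , e-ys , respects = covering (proj₂ (proj₂ (φ i) l))
    in Equivalence.from (respects (ys VF.++ zs) (xs VF.++ (e ∘ zs)) (++-image e e-ys zs))
                        (sat l (e ∘ zs))

  -- For ∀x̄ ∃ȳ θ: pull x̄ back to X, find ȳ there, and push it forward.
  Π2-transfer : Covers X Y → ∀ φ → SatΠ2 L X φ → SatΠ2 L Y φ
  Π2-transfer cover φ sat l ys =
    let xs , covering = cover ys
        i , zs , satθ = sat l xs
        e , e-xs , respects = covering (proj₂ (proj₂ (φ l) i))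
    in i , e ∘ zs ,
       Equivalence.to (respects (xs VF.++ zs) (ys VF.++ (e ∘ zs)) (++-image e e-xs zs)) satθ

  covers⇒modelOfTh2 : Covers Y X → Covers X Y → ModelOfTh2 L X Y
  covers⇒modelOfTh2 coverYX coverXY = Σ2-transfer coverYX , Π2-transfer coverXY

-- Signature of the forest: unary function symbols 0 ("up") and suc i
-- ("child i"), and one unary relation symbol P.
ForestSig : Signature
ForestSig = record
  { Fun = ℕ ; funArity = λ _ → 1 ; Rel = ⊤ ; relArity = λ _ → 1
  ; funCode = id ; funCode-inj = id ; relCode = λ _ → 0 ; relCode-inj = λ _ → refl }

-- The node (j , p) lies in the tree of root rⱼ, reached from rⱼ by the labels
-- in p (the head of p is the last step).
Node : Set
Node = ℕ × List ℕ

up : Node → Node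
up (j , [])    = suc j , []
up (j , i ∷ p) = j , p

child : ℕ → Node → Node
child i (j , p) = j , i ∷ p

forestFun : (f : ℕ) → Vec Node 1 → Node
forestFun zero    (x ∷ []) = up x
forestFun (suc i) (x ∷ []) = child i x

-- Parity of the number of steps from r₀ to a node: every root-to-root up
-- step and every child step flips it.
parity : Node → Bool
parity (j     , i ∷ p) = not (parity (j , p))
parity (zero  , [])    = false
parity (suc j , [])    = not (parity (j , []))

parity-suc : ∀ j p → parity (suc j , p) ≡ not (parity (j , p))
parity-suc j []      = refl
parity-suc j (i ∷ p) = cong not (parity-suc j p)

parity-pred : ∀ j p → parity (j , p) ≡ not (parity (suc j , p))
parity-pred j p = trans (sym (not-involutive _)) (cong not (sym (parity-suc j p)))

Forest : Bool → Structure ForestSig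
Forest b = record
  { Carrier = Node ; funI = forestFun ; relI = λ _ xs → parity (V.head xs) ≡ b }

rootTerm : ℕ → Term ForestSig 1
rootTerm zero    = var F.zero
rootTerm (suc j) = app 0 (rootTerm j ∷ [])

nodeTerm : Node → Term ForestSig 1
nodeTerm (j , [])    = rootTerm j
nodeTerm (j , i ∷ p) = app (suc i) (nodeTerm (j , p) ∷ [])

r₀ : Fin 1 → Node
r₀ _ = 0 , []

eval-rootTerm : ∀ b j → evalT ForestSig (Forest b) r₀ (rootTerm j) ≡ (j , [])
eval-rootTerm b zero    = refl
eval-rootTerm b (suc j) = cong up (eval-rootTerm b j)

eval-nodeTerm : ∀ b x → evalT ForestSig (Forest b) r₀ (nodeTerm x) ≡ x
eval-nodeTerm b (j , [])    = eval-rootTerm b j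
eval-nodeTerm b (j , i ∷ p) = cong (child i) (eval-nodeTerm b (j , p))

forest-finitelyGenerated : ∀ b → FinitelyGenerated ForestSig (Forest b)
forest-finitelyGenerated b = 1 , r₀ , λ x → nodeTerm x , eval-nodeTerm b x

σ : Node → Node
σ (j , p) = suc j , p

-- The shift D_c.  It maps tree r₀ into the subtree below child c of r₀, tree
-- r₁ onto tree r₀ with the labels of first steps moved off c by bump, and tree rⱼ₊₂
-- onto tree rⱼ₊₁.
module Shift (c : ℕ) where

  bump : ℕ → ℕ
  bump x with x <? c
  ... | yes _ = x
  ... | no  _ = suc x

  unbump : ℕ → ℕ
  unbump y with y <? c
  ... | yes _ = y
  ... | no  _ = pred y

  bump-below : ∀ {x} → x < c → bump x ≡ x
  bump-below {x} x<c with x <? c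
  ... | yes _   = refl
  ... | no  x≮c = ⊥-elim (x≮c x<c)

  bump≢c : ∀ x → bump x ≢ c
  bump≢c x bx≡c with x <? c
  ... | yes x<c = <-irrefl bx≡c x<c
  ... | no  x≮c = x≮c (subst (x <_) bx≡c ≤-refl)

  unbump-below : ∀ {y} → y < c → unbump y ≡ y
  unbump-below {y} y<c with y <? c
  ... | yes _   = refl
  ... | no  y≮c = ⊥-elim (y≮c y<c)

  unbump-above : ∀ {y} → ¬ y < c → unbump y ≡ pred y
  unbump-above {y} y≮c with y <? c
  ... | yes y<c = ⊥-elim (y≮c y<c)
  ... | no  _   = refl

  unbump-bump : ∀ x → unbump (bump x) ≡ x
  unbump-bump x with x <? c
  ... | yes x<c = unbump-below x<c
  ... | no  x≮c = unbump-above (λ sx<c → x≮c (<-trans (n<1+n x) sx<c))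

  bump-injective : ∀ {x y} → bump x ≡ bump y → x ≡ y
  bump-injective {x} {y} bx≡by =
    trans (sym (unbump-bump x)) (trans (cong unbump bx≡by) (unbump-bump y))

  -- Apply bump to the label of the first step from the root (the last entry).
  relab : List ℕ → List ℕ
  relab []          = []
  relab (x ∷ [])    = bump x ∷ []
  relab (x ∷ y ∷ p) = x ∷ relab (y ∷ p)

  relab-injective : ∀ p q → relab p ≡ relab q → p ≡ q
  relab-injective []          []            _ = refl
  relab-injective (x ∷ [])    (y ∷ [])      e = cong [_] (bump-injective (∷-injectiveˡ e))
  relab-injective (x ∷ y ∷ p) (x' ∷ y' ∷ q) e =
    cong₂ _∷_ (∷-injectiveˡ e) (relab-injective (y ∷ p) (y' ∷ q) (∷-injectiveʳ e))
  relab-injective []              (_ ∷ [])         ()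
  relab-injective []              (_ ∷ _ ∷ _)      ()
  relab-injective (_ ∷ [])        []               ()
  relab-injective (_ ∷ [])        (_ ∷ _ ∷ [])     ()
  relab-injective (_ ∷ [])        (_ ∷ _ ∷ _ ∷ _)  ()
  relab-injective (_ ∷ _ ∷ _)     []               ()
  relab-injective (_ ∷ _ ∷ [])    (_ ∷ [])         ()
  relab-injective (_ ∷ _ ∷ _ ∷ _) (_ ∷ [])         ()

  -- The images of trees r₀ and r₁ are disjoint: only the first begins with c.
  ++c≢relab : ∀ p q → p ++ [ c ] ≢ relab q
  ++c≢relab []          (y ∷ [])    e = bump≢c y (sym (∷-injectiveˡ e))
  ++c≢relab (x ∷ p)     (y ∷ z ∷ q) e = ++c≢relab p (z ∷ q) (∷-injectiveʳ e)
  ++c≢relab []          []              ()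
  ++c≢relab []          (_ ∷ _ ∷ [])    ()
  ++c≢relab []          (_ ∷ _ ∷ _ ∷ _) ()
  ++c≢relab (_ ∷ _)     []              ()
  ++c≢relab (_ ∷ [])    (_ ∷ [])        ()
  ++c≢relab (_ ∷ _ ∷ _) (_ ∷ [])        ()

  D : Node → Node
  D (zero , p)        = zero , p ++ [ c ]
  D (suc zero , p)    = zero , relab p
  D (suc (suc j) , p) = suc j , p

  D-injective : ∀ x y → D x ≡ D y → x ≡ y
  D-injective (zero , p) (zero , q) e =
    cong (zero ,_) (++-cancelʳ [ c ] p q (cong proj₂ e))
  D-injective (zero , p) (suc zero , q) e = ⊥-elim (++c≢relab p q (cong proj₂ e))
  D-injective (suc zero , p) (zero , q) e = ⊥-elim (++c≢relab q p (sym (cong proj₂ e)))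
  D-injective (suc zero , p) (suc zero , q) e =
    cong (suc zero ,_) (relab-injective p q (cong proj₂ e))
  D-injective (suc (suc j) , p) (suc (suc k) , q) refl = refl
  D-injective (zero , _)     (suc (suc _) , _) ()
  D-injective (suc zero , _) (suc (suc _) , _) ()
  D-injective (suc (suc _) , _) (zero , _)     ()
  D-injective (suc (suc _) , _) (suc zero , _) ()

  -- D commutes with up; at the junction, the parent of D r₀ = (0 , [ c ]) is
  -- r₀ = D r₁.
  D-up : ∀ x → D (up x) ≡ up (D x)
  D-up (zero , [])            = refl
  D-up (zero , i ∷ p)         = refl
  D-up (suc zero , [])        = refl
  D-up (suc zero , i ∷ [])    = refl
  D-up (suc zero , i ∷ y ∷ p) = refl
  D-up (suc (suc j) , [])     = refl
  D-up (suc (suc j) , i ∷ p)  = refl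

  -- Below c the labels are untouched, so D commutes with child i for i < c.
  D-child : ∀ {i} → i < c → ∀ x → D (child i x) ≡ child i (D x)
  D-child i<c (zero , p)         = refl
  D-child i<c (suc zero , [])    = cong (λ l → zero , l ∷ []) (bump-below i<c)
  D-child i<c (suc zero , y ∷ p) = refl
  D-child i<c (suc (suc j) , p)  = refl

  parity-++c : ∀ j p → parity (j , p ++ [ c ]) ≡ not (parity (j , p))
  parity-++c j []      = refl
  parity-++c j (i ∷ p) = cong not (parity-++c j p)

  parity-relab : ∀ j p → parity (j , relab p) ≡ parity (j , p)
  parity-relab j []          = refl
  parity-relab j (x ∷ [])    = refl
  parity-relab j (x ∷ y ∷ p) = cong not (parity-relab j (y ∷ p))

  parity-D : ∀ x → parity (D x) ≡ not (parity x)
  parity-D (zero , p)        = parity-++c zero p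
  parity-D (suc zero , p)    = trans (parity-relab zero p) (parity-pred zero p)
  parity-D (suc (suc j) , p) = parity-pred (suc j) p

  shift-embedding : ∀ b → FragmentEmbedding (_< c) (Forest b) (Forest (not b))
  shift-embedding b = record
    { embed     = D
    ; injective = D-injective _ _
    ; embed-fun = λ { zero _ (x ∷ []) → D-up x
                    ; (suc i) si<c (x ∷ []) → D-child (<-trans (n<1+n i) si<c) x }
    ; embed-rel = λ { _ (x ∷ []) → mk⇔
                        (λ px≡b → trans (parity-D x) (cong not px≡b))
                        (λ pDx≡nb → not-injective (trans (sym (parity-D x)) pDx≡nb)) }
    }

  relab-small : ∀ p → sum p < c → relab p ≡ p
  relab-small []          _   = refl
  relab-small (x ∷ [])    p<c = cong [_] (bump-below (≤-<-trans (m≤m+n x 0) p<c))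
  relab-small (x ∷ y ∷ p) p<c = cong (x ∷_) (relab-small (y ∷ p) (≤-<-trans (m≤n+m _ x) p<c))

  D-σ : ∀ x → sum (proj₂ x) < c → D (σ x) ≡ x
  D-σ (zero , p)  p<c = cong (zero ,_) (relab-small p p<c)
  D-σ (suc j , p) _   = refl

symbolBoundT : ∀ {n} → Term ForestSig n → ℕ
symbolBoundT (var i)          = 0
symbolBoundT (app f (t ∷ [])) = suc f ⊔ symbolBoundT t

symbolBound : ∀ {n} → QF ForestSig n → ℕ
symbolBound tt               = 0
symbolBound ff               = 0
symbolBound (eq s t)         = symbolBoundT s ⊔ symbolBoundT t
symbolBound (rel r (t ∷ [])) = symbolBoundT t
symbolBound (neg φ)          = symbolBound φ
symbolBound (and φ ψ)        = symbolBound φ ⊔ symbolBound ψ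
symbolBound (or φ ψ)         = symbolBound φ ⊔ symbolBound ψ

within-boundT : ∀ {n c} (t : Term ForestSig n) → symbolBoundT t ≤ c → WithinT (_< c) t
within-boundT (var i)          _   = tt
within-boundT (app f (t ∷ [])) b≤c =
  m⊔n≤o⇒m≤o (suc f) (symbolBoundT t) b≤c ,
  within-boundT t (m⊔n≤o⇒n≤o (suc f) (symbolBoundT t) b≤c) , tt

within-bound : ∀ {n c} (θ : QF ForestSig n) → symbolBound θ ≤ c → WithinQF (_< c) θ
within-bound tt               _   = tt
within-bound ff               _   = tt
within-bound (eq s t)         b≤c =
  within-boundT s (m⊔n≤o⇒m≤o _ _ b≤c) , within-boundT t (m⊔n≤o⇒n≤o _ _ b≤c)
within-bound (rel r (t ∷ [])) b≤c = within-boundT t b≤c , tt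
within-bound (neg φ)          b≤c = within-bound φ b≤c
within-bound (and φ ψ)        b≤c =
  within-bound φ (m⊔n≤o⇒m≤o _ _ b≤c) , within-bound ψ (m⊔n≤o⇒n≤o _ _ b≤c)
within-bound (or φ ψ)         b≤c =
  within-bound φ (m⊔n≤o⇒m≤o _ _ b≤c) , within-bound ψ (m⊔n≤o⇒n≤o _ _ b≤c)

finite-bound : ∀ {k} (f : Fin k → ℕ) → Σ ℕ λ N → ∀ j → f j ≤ N
finite-bound {zero}  f = 0 , λ ()
finite-bound {suc k} f =
  f F.zero ⊔ N , λ { F.zero → m≤m⊔n _ N ; (F.suc j) → ≤-trans (N-bounds j) (m≤n⊔m _ N) }
  where
  N : ℕ
  N = proj₁ (finite-bound (f ∘ F.suc))
  N-bounds : ∀ j → f (F.suc j) ≤ N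
  N-bounds = proj₂ (finite-bound (f ∘ F.suc))

-- Each forest covers the other: given ȳ and θ, choose c above the symbols of
-- θ and the labels of ȳ; then D_c maps σ ȳ back to ȳ and respects θ.
forest-covers : ∀ b → Covers (Forest b) (Forest (not b))
forest-covers b {k} ys = σ ∘ ys , λ θ →
  Shift.D (bound θ) ,
  (λ j → Shift.D-σ (bound θ) (ys j) (s≤s (≤-trans (N-bounds j) (m≤n⊔m _ N)))) ,
  embedding-respects (Shift.shift-embedding (bound θ) b) θ
    (within-bound θ (≤-trans (m≤m⊔n _ N) (n≤1+n _)))
  where
  N : ℕ
  N = proj₁ (finite-bound (sum ∘ proj₂ ∘ ys))
  N-bounds : ∀ j → sum (proj₂ (ys j)) ≤ N
  N-bounds = proj₂ (finite-bound (sum ∘ proj₂ ∘ ys))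
  bound : ∀ {m} → QF ForestSig (k + m) → ℕ
  bound θ = suc (symbolBound θ ⊔ N)

-- An isomorphism preserves
-- and reflects roots (children are never roots) and commutes with up, so it
-- fixes r₀, the only root that is not up of a root; but P holds at r₀ in
-- Forest false and fails there in Forest true.
module NoIsomorphism (I : Iso ForestSig (Forest false) (Forest true)) where
  open Iso I

  IsRoot : Node → Set
  IsRoot x = proj₂ x ≡ []

  to-up : ∀ x → to (up x) ≡ up (to x)
  to-up x = pres-fun 0 (x ∷ [])

  to-child : ∀ i x → to (child i x) ≡ child i (to x)
  to-child i x = pres-fun (suc i) (x ∷ [])

  to-injective : ∀ {x y} → to x ≡ to y → x ≡ y
  to-injective {x} {y} e = trans (sym (from-to x)) (trans (cong from e) (from-to y))

  child-not-root : ∀ i x → ¬ IsRoot (child i x)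
  child-not-root i x ()

  up-root≢r₀ : ∀ x → IsRoot x → up x ≢ (0 , [])
  up-root≢r₀ (j , []) _ ()

  roots-reflected : ∀ x → IsRoot (to x) → IsRoot x
  roots-reflected (j , [])    _    = refl
  roots-reflected (j , i ∷ p) root =
    ⊥-elim (child-not-root i (to (j , p)) (subst IsRoot (to-child i (j , p)) root))

  -- If to rⱼ were the child i of (k , q), then rⱼ would be child i of
  -- from (k , q).
  roots-preserved : ∀ j → IsRoot (to (j , []))
  roots-preserved j with to (j , []) in to-rⱼ
  ... | k , []    = refl
  ... | k , i ∷ q = ⊥-elim (child-not-root i y (subst IsRoot (sym child≡rⱼ) refl))
    where
    y : Node
    y = from (k , q)
    child≡rⱼ : child i y ≡ (j , [])
    child≡rⱼ = to-injective
      (trans (to-child i y) (trans (cong (child i) (to-from (k , q))) (sym to-rⱼ)))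

  -- If to r₀ were rₖ₊₁ = up rₖ, then r₀ would be up of the root from rₖ.
  fixes-r₀ : to (0 , []) ≡ (0 , [])
  fixes-r₀ with to (0 , []) in to-r₀ | roots-preserved 0
  ... | zero  , []    | _ = refl
  ... | _     , _ ∷ _ | ()
  ... | suc k , []    | _ =
    ⊥-elim (up-root≢r₀ y (roots-reflected y (subst IsRoot (sym (to-from (k , []))) refl)) up-y≡r₀)
    where
    y : Node
    y = from (k , [])
    up-y≡r₀ : up y ≡ (0 , [])
    up-y≡r₀ = to-injective (trans (to-up y) (trans (cong up (to-from (k , []))) (sym to-r₀)))

  absurd : ⊥
  absurd with trans (sym (cong parity fixes-r₀)) (pres-rel tt ((0 , []) ∷ []) refl)
  ... | ()

theorem5p16 : Σ Signature (λ L → Σ (Structure L) (λ A →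
    FinitelyGenerated L A × ¬ QuasiCategoricalTh2 L A))
theorem5p16 =
  ForestSig , Forest false , forest-finitelyGenerated false , not-quasi-categorical
  where
  forestTrue⊨Th₂ : ModelOfTh2 ForestSig (Forest false) (Forest true)
  forestTrue⊨Th₂ = covers⇒modelOfTh2 (forest-covers true) (forest-covers false)

  not-quasi-categorical : ¬ QuasiCategoricalTh2 ForestSig (Forest false)
  not-quasi-categorical quasiCategorical = NoIsomorphism.absurd
    (quasiCategorical (Forest true) (forest-finitelyGenerated true) forestTrue⊨Th₂)
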